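{- A graph $G$ is LUCS if and only if it is $\{\overline{P_4+K_1},\overline{P_3+2K_1},\overline{2K_2+K_1}\}$-free.
   Context: A graph is complete split if its vertex set can be partitioned into a clique $K$ and a maximum independent set $S$ with every vertex of $K$ adjacent to every vertex of $S$. $G$ is locally union of complete split (LUCS) if for every vertex $v$, every connected component of $G[N(v)]$ is complete split. For a family $\mathcal H$ of graphs, $G$ is $\mathcal H$-free if it has no induced subgraph isomorphic to a member of $\mathcal H$; $\overline{H}$ denotes the complement and $+$ disjoint union. -}

module Defs where

open import Data.Nat using (ℕ; _≤_)
open import Data.Bool using (Bool; true; false; not; _∨_; _∧_; if_then_else_)
open import Data.Bool.Properties using (∨-comm)
open import Data.Fin using (Fin; zero; suc; _≟_)
open import Data.Fin.Subset using (Subset; _∈_; _∉_; _⊆_; ∣_∣)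
open import Data.Product using (Σ; ∃; _×_; _,_)
open import Data.Sum using (_⊎_)
open import Relation.Nullary using (¬_)
open import Relation.Nullary.Decidable using (⌊_⌋)
open import Relation.Binary.PropositionalEquality using (_≡_; _≢_; refl)
open import Function.Definitions using (Injective)

record Graph : Set where
  field
    n      : ℕ
    adj    : Fin n → Fin n → Bool
    sym    : ∀ x y → adj x y ≡ adj y x
    irrefl : ∀ x → adj x x ≡ false
open Graph public

complement : Graph → Graph
complement G = record
  { n = n G
  ; adj = λ x y → not (adj G x y ∨ ⌊ x ≟ y ⌋)
  ; sym = λ x y → cong2 x y
  ; irrefl = λ x → irr x
  }
  where
  open import Relation.Binary.PropositionalEquality using (cong; cong₂)
  cong2 : ∀ x y → not (adj G x y ∨ ⌊ x ≟ y ⌋) ≡ not (adj G y x ∨ ⌊ y ≟ x ⌋)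
  cong2 x y with x ≟ y | y ≟ x
  ... | Relation.Nullary.yes _ | Relation.Nullary.yes _ rewrite ∨-comm (adj G x y) true | ∨-comm (adj G y x) true = refl
  ... | Relation.Nullary.yes refl | Relation.Nullary.no q with q refl
  ... | ()
  cong2 x y | Relation.Nullary.no q | Relation.Nullary.yes refl with q refl
  ... | ()
  cong2 x y | Relation.Nullary.no _ | Relation.Nullary.no _ = cong (λ b → not (b ∨ false)) (sym G x y)
  irr : ∀ x → not (adj G x x ∨ ⌊ x ≟ x ⌋) ≡ false
  irr x with x ≟ x
  ... | Relation.Nullary.yes _ rewrite ∨-comm (adj G x x) true = refl
  ... | Relation.Nullary.no q with q refl
  ... | ()

module Small (e : Fin 5 → Fin 5 → Bool) (e-irr : ∀ x → e x x ≡ false) where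
  graph : Graph
  graph = record
    { n = 5
    ; adj = λ x y → e x y ∨ e y x
    ; sym = λ x y → ∨-comm (e x y) (e y x)
    ; irrefl = λ x → irr x
    }
    where
    irr : ∀ x → e x x ∨ e x x ≡ false
    irr x rewrite e-irr x = refl

-- P4 + K1 : path 0-1-2-3, vertex 4 isolated.
eP4K1 : Fin 5 → Fin 5 → Bool
eP4K1 zero (suc zero) = true
eP4K1 (suc zero) (suc (suc zero)) = true
eP4K1 (suc (suc zero)) (suc (suc (suc zero))) = true
eP4K1 _ _ = false

-- P3 + 2K1 : path 0-1-2, vertices 3, 4 isolated.
eP32K1 : Fin 5 → Fin 5 → Bool
eP32K1 zero (suc zero) = true
eP32K1 (suc zero) (suc (suc zero)) = true
eP32K1 _ _ = false

-- 2K2 + K1 : edges 0-1 and 2-3, vertex 4 isolated.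
e2K2K1 : Fin 5 → Fin 5 → Bool
e2K2K1 zero (suc zero) = true
e2K2K1 (suc (suc zero)) (suc (suc (suc zero))) = true
e2K2K1 _ _ = false

private
  irrP4K1 : ∀ x → eP4K1 x x ≡ false
  irrP4K1 zero = refl
  irrP4K1 (suc zero) = refl
  irrP4K1 (suc (suc zero)) = refl
  irrP4K1 (suc (suc (suc zero))) = refl
  irrP4K1 (suc (suc (suc (suc zero)))) = refl

  irrP32K1 : ∀ x → eP32K1 x x ≡ false
  irrP32K1 zero = refl
  irrP32K1 (suc zero) = refl
  irrP32K1 (suc (suc zero)) = refl
  irrP32K1 (suc (suc (suc zero))) = refl
  irrP32K1 (suc (suc (suc (suc zero)))) = refl

  irr2K2K1 : ∀ x → e2K2K1 x x ≡ false
  irr2K2K1 zero = refl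
  irr2K2K1 (suc zero) = refl
  irr2K2K1 (suc (suc zero)) = refl
  irr2K2K1 (suc (suc (suc zero))) = refl
  irr2K2K1 (suc (suc (suc (suc zero)))) = refl

P4+K1 : Graph
P4+K1 = Small.graph eP4K1 irrP4K1

P3+2K1 : Graph
P3+2K1 = Small.graph eP32K1 irrP32K1

2K2+K1 : Graph
2K2+K1 = Small.graph e2K2K1 irr2K2K1

InducedSub : Graph → Graph → Set
InducedSub H G = Σ (Fin (n H) → Fin (n G)) λ f →
  Injective _≡_ _≡_ f × (∀ i j → adj G (f i) (f j) ≡ adj H i j)

Free3 : Graph → Graph → Graph → Graph → Set
Free3 H1 H2 H3 G = ¬ InducedSub H1 G × ¬ InducedSub H2 G × ¬ InducedSub H3 G

-- Walk from x to y using only vertices of C (x ∈ C assumed separately).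
data WalkIn (G : Graph) (C : Subset (n G)) : Fin (n G) → Fin (n G) → Set where
  here : ∀ {x} → WalkIn G C x x
  step : ∀ {x z y} → adj G x z ≡ true → z ∈ C → WalkIn G C z y → WalkIn G C x y

-- C is (the vertex set of) a connected component of G[N(v)].
IsComponentOfNbhd : (G : Graph) → Fin (n G) → Subset (n G) → Set
IsComponentOfNbhd G v C =
  (∀ u → u ∈ C → adj G v u ≡ true) ×
  (∃ λ u → u ∈ C) ×
  (∀ x y → x ∈ C → y ∈ C → WalkIn G C x y) ×
  (∀ x y → x ∈ C → adj G v y ≡ true → adj G x y ≡ true → y ∈ C)

IsClique : (G : Graph) → Subset (n G) → Set
IsClique G K = ∀ x y → x ∈ K → y ∈ K → x ≢ y → adj G x y ≡ true

IsIndependent : (G : Graph) → Subset (n G) → Set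
IsIndependent G S = ∀ x y → x ∈ S → y ∈ S → adj G x y ≡ false

CompleteSplit : (G : Graph) → Subset (n G) → Set
CompleteSplit G C = Σ (Subset (n G)) λ K → Σ (Subset (n G)) λ S →
  K ⊆ C × S ⊆ C ×
  (∀ x → x ∈ C → (x ∈ K × x ∉ S) ⊎ (x ∈ S × x ∉ K)) ×
  IsClique G K × IsIndependent G S ×
  (∀ T → T ⊆ C → IsIndependent G T → ∣ T ∣ ≤ ∣ S ∣) ×
  (∀ x y → x ∈ K → y ∈ S → adj G x y ≡ true)

LUCS : Graph → Set
LUCS G = ∀ v C → IsComponentOfNbhd G v C → CompleteSplit G C

-- Each forbidden graph is a cone K₁ ∨ H with H ∈ {P₄, paw, C₄}, so G is free of them exactly when no
-- neighbourhood N(v) induces a P₄, a paw or a C₄. A nonempty vertex set C induces a complete split graph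
-- iff its non-universal vertices (those with a non-neighbour in C) are pairwise non-adjacent: they then
-- form the maximum independent set (any single vertex if C is a clique) and the others the clique.
-- In P₄, paw and C₄ two adjacent vertices have non-neighbours, so a LUCS graph contains none of the cones.
-- Conversely, in a connected {P₄, paw, C₄}-free graph every edge xy dominates (a walk leaving N[x] ∪ N[y]
-- creates a paw or a P₄); hence non-neighbours a of x and b of y are adjacent to y and to x, and then
-- x y a b is a C₄ or b x y a a P₄.

module Submission where

open import Data.Bool using (Bool; true; false; if_then_else_)
open import Data.Bool.Properties using (T-≡; ¬-not) renaming (_≟_ to _≟ᴮ_)
open import Data.Empty using (⊥; ⊥-elim)
open import Data.Unit using (⊤)
open import Data.Fin using (Fin; zero; suc; _≟_)
open import Data.Fin.Properties using (any?)
open import Data.Fin.Subset using (Subset; _∈_; _∉_; _⊆_; ∣_∣; ⁅_⁆; Nonempty)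
open import Data.Fin.Subset.Properties
  using (_∈?_; nonempty?; x∈⁅x⁆; x∈⁅y⁆⇒x≡y; ∣⁅x⁆∣≡1; p⊆q⇒∣p∣≤∣q∣; p⊂q⇒∣p∣<∣q∣; ∣p∣≤n)
open import Data.Nat using (ℕ; zero; suc; _+_; _≤_; _<_)
open import Data.Nat.Properties using (≤-trans; ≤-reflexive; <-≤-trans; <-irrefl; m≤m+n; +-suc; +-monoʳ-≤)
open import Data.Product using (∃; _×_; _,_; proj₁; proj₂)
open import Data.Sum using (_⊎_; inj₁; inj₂)
open import Data.Vec using (_∷_; []; lookup; tabulate)
open import Data.Vec.Properties using (lookup∘tabulate; lookup⇒[]=; []=⇒lookup)
open import Function.Base using (_∘_; _$_)
open import Function.Bundles using (_⇔_; mk⇔; Equivalence)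
open import Function.Definitions using (Injective)
open import Level using (Level)
open import Relation.Nullary using (¬_; Dec; yes; no; contradiction)
open import Relation.Nullary.Decidable
  using (⌊_⌋; _×-dec_; _⊎-dec_; ¬?; toWitness; fromWitness; decidable-stable)
open import Relation.Unary using (Pred; Decidable)
open import Relation.Binary.PropositionalEquality using (_≡_; _≢_; refl; sym; trans; subst; cong; ≢-sym)

open import Defs hiding (sym)

private
  variable
    ℓ : Level
    m : ℕ

pattern i0 = zero
pattern i1 = suc zero
pattern i2 = suc (suc zero)
pattern i3 = suc (suc (suc zero))
pattern i4 = suc (suc (suc (suc zero)))

subset : {P : Pred (Fin m) ℓ} → Decidable P → Subset m
subset P? = tabulate (λ x → ⌊ P? x ⌋)

module _ {P : Pred (Fin m) ℓ} (P? : Decidable P) {x : Fin m} where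

  ∈-subset⁺ : P x → x ∈ subset P?
  ∈-subset⁺ px = lookup⇒[]= x _ (trans (lookup∘tabulate _ x) (Equivalence.to T-≡ (fromWitness px)))

  ∈-subset⁻ : x ∈ subset P? → P x
  ∈-subset⁻ x∈ = toWitness (Equivalence.from T-≡ (trans (sym (lookup∘tabulate _ x)) ([]=⇒lookup x∈)))

x∈p⇒0<∣p∣ : ∀ {x} {p : Subset m} → x ∈ p → 0 < ∣ p ∣
x∈p⇒0<∣p∣ {x = x} x∈p =
  subst (_≤ _) (∣⁅x⁆∣≡1 x) (p⊆q⇒∣p∣≤∣q∣ λ y∈⁅x⁆ → subst (_∈ _) (sym (x∈⁅y⁆⇒x≡y x y∈⁅x⁆)) x∈p)

p⊆⁅x⁆⇒∣p∣≤1 : ∀ {x} {p : Subset m} → p ⊆ ⁅ x ⁆ → ∣ p ∣ ≤ 1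
p⊆⁅x⁆⇒∣p∣≤1 {x = x} p⊆⁅x⁆ = subst (_ ≤_) (∣⁅x⁆∣≡1 x) (p⊆q⇒∣p∣≤∣q∣ p⊆⁅x⁆)

inflationary-fixpoint : (F : Subset m → Subset m) → (∀ p → p ⊆ F p) →
  (P : Subset m → Set ℓ) → (∀ {p} → P p → P (F p)) →
  ∀ {p} → P p → ∃ λ q → P q × F q ⊆ q
inflationary-fixpoint {m = m} F p⊆Fp P P-F = iterate m (m≤m+n m _)
  where
  -- Fuel: every strict enlargement increases ∣ p ∣, which is at most m.
  iterate : ∀ k {p} → m ≤ k + ∣ p ∣ → P p → ∃ λ q → P q × F q ⊆ q
  iterate k {p} _ Pp with any? (λ x → (x ∈? F p) ×-dec ¬? (x ∈? p))
  ... | no stable = p , Pp , λ {x} x∈Fp → decidable-stable (x ∈? p) λ x∉p → stable (x , x∈Fp , x∉p)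
  iterate zero {p} m≤∣p∣ _ | yes grows =
    contradiction (<-≤-trans (p⊂q⇒∣p∣<∣q∣ (p⊆Fp p , grows)) (≤-trans (∣p∣≤n (F p)) m≤∣p∣)) (<-irrefl refl)
  iterate (suc k) {p} m≤1+k+∣p∣ Pp | yes grows =
    iterate k (≤-trans m≤1+k+∣p∣ (≤-trans (≤-reflexive (sym (+-suc k ∣ p ∣)))
                                           (+-monoʳ-≤ k (p⊂q⇒∣p∣<∣q∣ (p⊆Fp p , grows)))))
              (P-F Pp)

cons-injective : ∀ {A : Set ℓ} {f : Fin (suc m) → A} →
  (∀ j → f zero ≢ f (suc j)) → Injective _≡_ _≡_ (f ∘ suc) → Injective _≡_ _≡_ f
cons-injective _ _ {zero} {zero} _ = refl
cons-injective f0∉ _ {zero} {suc j} p = contradiction p (f0∉ j)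
cons-injective f0∉ _ {suc i} {zero} p = contradiction (sym p) (f0∉ i)
cons-injective _ f∘suc-inj {suc i} {suc j} p = cong suc (f∘suc-inj p)

-- The complements are the cones K₁ ∨ P₄ (the gem), K₁ ∨ paw and K₁ ∨ C₄ (the wheel W₄).
gem K₁∨paw W₄ : Graph
gem = complement P4+K1
K₁∨paw = complement P3+2K1
W₄ = complement 2K2+K1

module _ (G : Graph) where

  private
    V = Fin (n G)
    variable
      v x y z z′ a b c d : V
      C D : Subset (n G)

  infix 4 _~_ _≁_ _∈N[_]

  _~_ _≁_ : V → V → Set
  x ~ y = adj G x y ≡ true
  x ≁ y = adj G x y ≡ false

  ~-sym : x ~ y → y ~ x
  ~-sym {x} {y} x~y = trans (Graph.sym G y x) x~y

  ≁-sym : x ≁ y → y ≁ x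
  ≁-sym {x} {y} x≁y = trans (Graph.sym G y x) x≁y

  ≁⇒¬~ : x ≁ y → ¬ x ~ y
  ≁⇒¬~ x≁y x~y with () ← trans (sym x~y) x≁y

  ¬~⇒≁ : ¬ x ~ y → x ≁ y
  ¬~⇒≁ = ¬-not

  ~⇒≢ : x ~ y → x ≢ y
  ~⇒≢ {x} x~y refl = ≁⇒¬~ (irrefl G x) x~y

  WalkIn-mono : C ⊆ D → WalkIn G C x y → WalkIn G D x y
  WalkIn-mono C⊆D here = here
  WalkIn-mono C⊆D (step x~z z∈C w) = step x~z (C⊆D z∈C) (WalkIn-mono C⊆D w)

  WalkIn-trans : WalkIn G C x y → WalkIn G C y z → WalkIn G C x z
  WalkIn-trans here w′ = w′
  WalkIn-trans (step x~z z∈C w) w′ = step x~z z∈C (WalkIn-trans w w′)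

  WalkIn-reverse : x ∈ C → WalkIn G C x y → WalkIn G C y x
  WalkIn-reverse x∈C here = here
  WalkIn-reverse x∈C (step x~z z∈C w) = WalkIn-trans (WalkIn-reverse z∈C w) (step (~-sym x~z) x∈C here)

  Expand : V → Subset (n G) → Pred V _
  Expand v R y = y ∈ R ⊎ (v ~ y × ∃ λ z → z ∈ R × z ~ y)

  expand? : ∀ v R → Decidable (Expand v R)
  expand? v R y =
    (y ∈? R) ⊎-dec ((adj G v y ≟ᴮ true) ×-dec any? λ z → (z ∈? R) ×-dec (adj G z y ≟ᴮ true))

  expand : V → Subset (n G) → Subset (n G)
  expand v R = subset (expand? v R)

  Rooted : V → V → Subset (n G) → Set
  Rooted v x R = (∀ u → u ∈ R → v ~ u) × x ∈ R × (∀ y → y ∈ R → WalkIn G R x y)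

  ⊆-expand : ∀ R → R ⊆ expand v R
  ⊆-expand {v} R = ∈-subset⁺ (expand? v R) ∘ inj₁

  rooted-⁅⁆ : v ~ x → Rooted v x ⁅ x ⁆
  rooted-⁅⁆ {v} {x} v~x = ⁅x⁆⊆N[v] , x∈⁅x⁆ x , λ y y∈⁅x⁆ → subst (WalkIn G ⁅ x ⁆ x) (sym (x∈⁅y⁆⇒x≡y x y∈⁅x⁆)) here
    where
    ⁅x⁆⊆N[v] : ∀ u → u ∈ ⁅ x ⁆ → v ~ u
    ⁅x⁆⊆N[v] u u∈⁅x⁆ = subst (v ~_) (sym (x∈⁅y⁆⇒x≡y x u∈⁅x⁆)) v~x

  rooted-expand : ∀ {R} → Rooted v x R → Rooted v x (expand v R)
  rooted-expand {v} {x} {R} (R⊆N[v] , x∈R , reach) = expand⊆N[v] , ⊆-expand R x∈R , reach′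
    where
    expand⊆N[v] : ∀ u → u ∈ expand v R → v ~ u
    expand⊆N[v] u u∈ with ∈-subset⁻ (expand? v R) u∈
    ... | inj₁ u∈R = R⊆N[v] u u∈R
    ... | inj₂ (v~u , _) = v~u

    reach′ : ∀ y → y ∈ expand v R → WalkIn G (expand v R) x y
    reach′ y y∈ with ∈-subset⁻ (expand? v R) y∈
    ... | inj₁ y∈R = WalkIn-mono (⊆-expand R) (reach y y∈R)
    ... | inj₂ (_ , z , z∈R , z~y) = WalkIn-trans (WalkIn-mono (⊆-expand R) (reach z z∈R)) (step z~y y∈ here)

  rooted-closed⇒component : Rooted v x C → expand v C ⊆ C → IsComponentOfNbhd G v C
  rooted-closed⇒component {v} {x} {C} (C⊆N[v] , x∈C , reach) expand⊆C =
    C⊆N[v] , (x , x∈C) , connected , closed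
    where
    connected : ∀ a b → a ∈ C → b ∈ C → WalkIn G C a b
    connected a b a∈C b∈C = WalkIn-trans (WalkIn-reverse x∈C (reach a a∈C)) (reach b b∈C)

    closed : ∀ a b → a ∈ C → v ~ b → a ~ b → b ∈ C
    closed a b a∈C v~b a~b = expand⊆C (∈-subset⁺ (expand? v C) (inj₂ (v~b , a , a∈C , a~b)))

  component-containing : v ~ x → ∃ λ C → IsComponentOfNbhd G v C × x ∈ C
  component-containing {v} {x} v~x =
    let C , C-rooted , expand⊆C = inflationary-fixpoint (expand v) ⊆-expand (Rooted v x) rooted-expand (rooted-⁅⁆ v~x)
    in C , rooted-closed⇒component C-rooted expand⊆C , proj₁ (proj₂ C-rooted)

  module _ {h : Fin 5 → Fin 5 → Bool} (h-sym : ∀ i j → h i j ≡ h j i) (h-irr : ∀ i → h i i ≡ false)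
           (f : Fin 5 → V) where

    -- For edges ij of h, f i ≢ f j already follows from adjacency.
    Separated : Fin 5 → Fin 5 → Set
    Separated i j = if h i j then ⊤ else f i ≢ f j

    inducedEmbedding₅ :
      Separated i0 i1 → Separated i0 i2 → Separated i0 i3 → Separated i0 i4 → Separated i1 i2 →
      Separated i1 i3 → Separated i1 i4 → Separated i2 i3 → Separated i2 i4 → Separated i3 i4 →
      let A = λ i j → adj G (f i) (f j) ≡ h i j in
      A i0 i1 → A i0 i2 → A i0 i3 → A i0 i4 → A i1 i2 →
      A i1 i3 → A i1 i4 → A i2 i3 → A i2 i4 → A i3 i4 →
      Injective _≡_ _≡_ f × (∀ i j → adj G (f i) (f j) ≡ h i j)
    inducedEmbedding₅ s01 s02 s03 s04 s12 s13 s14 s23 s24 s34 e01 e02 e03 e04 e12 e13 e14 e23 e24 e34 =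
      injective , adjacency
      where
      distinct : ∀ {i j} → Separated i j → adj G (f i) (f j) ≡ h i j → f i ≢ f j
      distinct {i} {j} s fi~fj with h i j
      ... | true = ~⇒≢ fi~fj
      ... | false = s

      injective : Injective _≡_ _≡_ f
      injective = cons-injective (λ { i0 → distinct s01 e01 ; i1 → distinct s02 e02 ; i2 → distinct s03 e03 ; i3 → distinct s04 e04 })
                $ cons-injective (λ { i0 → distinct s12 e12 ; i1 → distinct s13 e13 ; i2 → distinct s14 e14 })
                $ cons-injective (λ { i0 → distinct s23 e23 ; i1 → distinct s24 e24 })
                $ cons-injective (λ { i0 → distinct s34 e34 })
                $ λ { {i0} {i0} _ → refl }

      diagonal : ∀ i → adj G (f i) (f i) ≡ h i i
      diagonal i = trans (irrefl G (f i)) (sym (h-irr i))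

      flip : ∀ {i j} → adj G (f i) (f j) ≡ h i j → adj G (f j) (f i) ≡ h j i
      flip {i} {j} eq = trans (Graph.sym G (f j) (f i)) (trans eq (h-sym i j))

      adjacency : ∀ i j → adj G (f i) (f j) ≡ h i j
      adjacency i0 i1 = e01
      adjacency i0 i2 = e02
      adjacency i0 i3 = e03
      adjacency i0 i4 = e04
      adjacency i1 i2 = e12
      adjacency i1 i3 = e13
      adjacency i1 i4 = e14
      adjacency i2 i3 = e23
      adjacency i2 i4 = e24
      adjacency i3 i4 = e34
      adjacency i1 i0 = flip e01
      adjacency i2 i0 = flip e02
      adjacency i3 i0 = flip e03
      adjacency i4 i0 = flip e04
      adjacency i2 i1 = flip e12
      adjacency i3 i1 = flip e13
      adjacency i4 i1 = flip e14
      adjacency i3 i2 = flip e23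
      adjacency i4 i2 = flip e24
      adjacency i4 i3 = flip e34
      adjacency i0 i0 = diagonal i0
      adjacency i1 i1 = diagonal i1
      adjacency i2 i2 = diagonal i2
      adjacency i3 i3 = diagonal i3
      adjacency i4 i4 = diagonal i4

  IsInducedP4 IsInducedPaw IsInducedC4 : V → V → V → V → Set
  IsInducedP4 a b c d = a ~ b × b ~ c × c ~ d × a ≁ c × a ≁ d × b ≁ d × a ≢ c × a ≢ d × b ≢ d
  IsInducedPaw a b c d = a ~ b × b ~ c × c ~ a × c ~ d × a ≁ d × b ≁ d × a ≢ d × b ≢ d
  IsInducedC4 a b c d = a ~ b × b ~ c × c ~ d × d ~ a × a ≁ c × b ≁ d × a ≢ c × b ≢ d

  FreeOf : (V → V → V → V → Set) → Subset (n G) → Set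
  FreeOf P C = ∀ {a b c d} → a ∈ C → b ∈ C → c ∈ C → d ∈ C → ¬ P a b c d

  cone-P4⇒gem : v ~ a → v ~ b → v ~ c → v ~ d → IsInducedP4 a b c d → InducedSub gem G
  cone-P4⇒gem {v} {a} {b} {c} {d} v~a v~b v~c v~d (a~b , b~c , c~d , a≁c , a≁d , b≁d , a≢c , a≢d , b≢d) =
    _ , inducedEmbedding₅ (Graph.sym gem) (irrefl gem) (lookup (b ∷ d ∷ a ∷ c ∷ v ∷ []))
      b≢d _ _ _ (≢-sym a≢d) _ _ a≢c _ _
      b≁d (~-sym a~b) b~c (~-sym v~b) (≁-sym a≁d)
      (~-sym c~d) (~-sym v~d) a≁c (~-sym v~a) (~-sym v~c)

  cone-paw⇒K₁∨paw : v ~ a → v ~ b → v ~ c → v ~ d → IsInducedPaw a b c d → InducedSub K₁∨paw G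
  cone-paw⇒K₁∨paw {v} {a} {b} {c} {d} v~a v~b v~c v~d (a~b , b~c , c~a , c~d , a≁d , b≁d , a≢d , b≢d) =
    _ , inducedEmbedding₅ (Graph.sym K₁∨paw) (irrefl K₁∨paw) (lookup (a ∷ d ∷ b ∷ c ∷ v ∷ []))
      a≢d _ _ _ (≢-sym b≢d) _ _ _ _ _
      a≁d a~b (~-sym c~a) (~-sym v~a) (≁-sym b≁d)
      (~-sym c~d) (~-sym v~d) b~c (~-sym v~b) (~-sym v~c)

  cone-C4⇒W₄ : v ~ a → v ~ b → v ~ c → v ~ d → IsInducedC4 a b c d → InducedSub W₄ G
  cone-C4⇒W₄ {v} {a} {b} {c} {d} v~a v~b v~c v~d (a~b , b~c , c~d , d~a , a≁c , b≁d , a≢c , b≢d) =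
    _ , inducedEmbedding₅ (Graph.sym W₄) (irrefl W₄) (lookup (a ∷ c ∷ b ∷ d ∷ v ∷ []))
      a≢c _ _ _ _ _ _ b≢d _ _
      a≁c a~b (~-sym d~a) (~-sym v~a) (~-sym b~c)
      c~d (~-sym v~c) b≁d (~-sym v~b) (~-sym v~d)

  cone-free : ∀ H {P : V → V → V → V → Set} → (∀ {a b c d} → v ~ a → v ~ b → v ~ c → v ~ d → P a b c d → InducedSub H G) →
    ¬ InducedSub H G → (∀ u → u ∈ C → v ~ u) → FreeOf P C
  cone-free _ cone H-free C⊆N[v] a∈C b∈C c∈C d∈C =
    H-free ∘ cone (C⊆N[v] _ a∈C) (C⊆N[v] _ b∈C) (C⊆N[v] _ c∈C) (C⊆N[v] _ d∈C)

  Universal NonUniversal : Subset (n G) → V → Set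
  Universal C x = ∀ y → y ∈ C → y ≢ x → x ~ y
  NonUniversal C x = ∃ λ y → y ∈ C × y ≢ x × x ≁ y

  nonUniversal? : ∀ C → Decidable (NonUniversal C)
  nonUniversal? C x = any? λ y → (y ∈? C) ×-dec ¬? (y ≟ x) ×-dec (adj G x y ≟ᴮ false)

  ¬nonUniversal⇒universal : ¬ NonUniversal C x → Universal C x
  ¬nonUniversal⇒universal ¬nu y y∈C y≢x = ¬-not λ x≁y → ¬nu (y , y∈C , y≢x , x≁y)

  NonUniversalIndependent : Subset (n G) → Set
  NonUniversalIndependent C = ∀ {x y} → x ∈ C → y ∈ C → NonUniversal C x → NonUniversal C y → x ≁ y

  completeSplit⇒nonUniversalIndependent : CompleteSplit G C → NonUniversalIndependent C
  completeSplit⇒nonUniversalIndependent {C} (K , S , _ , _ , partition , K-clique , S-independent , _ , K-S-complete)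
    x∈C y∈C x-nu y-nu = S-independent _ _ (nonUniversal⇒∈S x∈C x-nu) (nonUniversal⇒∈S y∈C y-nu)
    where
    nonUniversal⇒∈S : x ∈ C → NonUniversal C x → x ∈ S
    nonUniversal⇒∈S {x} x∈C (y , y∈C , y≢x , x≁y) with partition x x∈C | partition y y∈C
    ... | inj₂ (x∈S , _) | _ = x∈S
    ... | inj₁ (x∈K , _) | inj₁ (y∈K , _) = contradiction (K-clique x y x∈K y∈K (≢-sym y≢x)) (≁⇒¬~ x≁y)
    ... | inj₁ (x∈K , _) | inj₂ (y∈S , _) = contradiction (K-S-complete x y x∈K y∈S) (≁⇒¬~ x≁y)

  -- S is automatically maximum: an independent subset of C meeting the clique K = C ∖ S is a singleton.
  completeSplit-intro : ∀ {S} → S ⊆ C → IsIndependent G S → Nonempty S →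
    (∀ x → x ∈ C → x ∉ S → Universal C x) → CompleteSplit G C
  completeSplit-intro {C} {S} S⊆C S-independent (s , s∈S) universal =
    K , S , K⊆C , S⊆C , partition , K-clique , S-independent , maximum , K-S-complete
    where
    K? : Decidable λ x → x ∈ C × x ∉ S
    K? x = (x ∈? C) ×-dec ¬? (x ∈? S)

    K = subset K?

    K⊆C : K ⊆ C
    K⊆C = proj₁ ∘ ∈-subset⁻ K?

    K-universal : ∀ {x} → x ∈ K → Universal C x
    K-universal x∈K with (x∈C , x∉S) ← ∈-subset⁻ K? x∈K = universal _ x∈C x∉S

    partition : ∀ x → x ∈ C → (x ∈ K × x ∉ S) ⊎ (x ∈ S × x ∉ K)
    partition x x∈C with x ∈? S
    ... | yes x∈S = inj₂ (x∈S , λ x∈K → proj₂ (∈-subset⁻ K? x∈K) x∈S)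
    ... | no x∉S = inj₁ (∈-subset⁺ K? (x∈C , x∉S) , x∉S)

    K-clique : IsClique G K
    K-clique x y x∈K y∈K x≢y = K-universal x∈K y (K⊆C y∈K) (≢-sym x≢y)

    K-S-complete : ∀ x y → x ∈ K → y ∈ S → x ~ y
    K-S-complete x y x∈K y∈S =
      K-universal x∈K y (S⊆C y∈S) λ { refl → proj₂ (∈-subset⁻ K? x∈K) y∈S }

    maximum : ∀ T → T ⊆ C → IsIndependent G T → ∣ T ∣ ≤ ∣ S ∣
    maximum T T⊆C T-independent with any? (λ x → (x ∈? T) ×-dec (x ∈? K))
    ... | yes (k , k∈T , k∈K) = ≤-trans (p⊆⁅x⁆⇒∣p∣≤1 T⊆⁅k⁆) (x∈p⇒0<∣p∣ s∈S)
      where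
      T⊆⁅k⁆ : T ⊆ ⁅ k ⁆
      T⊆⁅k⁆ {t} t∈T with t ≟ k
      ... | yes refl = x∈⁅x⁆ k
      ... | no t≢k = contradiction (K-universal k∈K t (T⊆C t∈T) t≢k) (≁⇒¬~ (T-independent k t k∈T t∈T))
    ... | no T∩K-empty = p⊆q⇒∣p∣≤∣q∣ T⊆S
      where
      T⊆S : T ⊆ S
      T⊆S {t} t∈T with t ∈? S
      ... | yes t∈S = t∈S
      ... | no t∉S = contradiction (t , t∈T , ∈-subset⁺ K? (T⊆C t∈T , t∉S)) T∩K-empty

  nonUniversalIn? : ∀ C → Decidable λ x → x ∈ C × NonUniversal C x
  nonUniversalIn? C x = (x ∈? C) ×-dec nonUniversal? C x

  nonUniversalIndependent⇒completeSplit : Nonempty C → NonUniversalIndependent C → CompleteSplit G C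
  nonUniversalIndependent⇒completeSplit {C} (u , u∈C) independent with nonempty? (subset (nonUniversalIn? C))
  ... | yes U-nonempty = completeSplit-intro U⊆C U-independent U-nonempty outside-U-universal
    where
    U⊆C : subset (nonUniversalIn? C) ⊆ C
    U⊆C = proj₁ ∘ ∈-subset⁻ (nonUniversalIn? C)

    U-independent : IsIndependent G (subset (nonUniversalIn? C))
    U-independent x y x∈U y∈U
      with (x∈C , x-nu) ← ∈-subset⁻ (nonUniversalIn? C) x∈U
         | (y∈C , y-nu) ← ∈-subset⁻ (nonUniversalIn? C) y∈U = independent x∈C y∈C x-nu y-nu

    outside-U-universal : ∀ x → x ∈ C → x ∉ subset (nonUniversalIn? C) → Universal C x
    outside-U-universal x x∈C x∉U =
      ¬nonUniversal⇒universal λ x-nu → x∉U (∈-subset⁺ (nonUniversalIn? C) (x∈C , x-nu))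
  ... | no U-empty = completeSplit-intro ⁅u⁆⊆C ⁅u⁆-independent (u , x∈⁅x⁆ u) all-universal
    where
    ⁅u⁆⊆C : ⁅ u ⁆ ⊆ C
    ⁅u⁆⊆C x∈⁅u⁆ = subst (_∈ C) (sym (x∈⁅y⁆⇒x≡y u x∈⁅u⁆)) u∈C

    ⁅u⁆-independent : IsIndependent G ⁅ u ⁆
    ⁅u⁆-independent x y x∈⁅u⁆ y∈⁅u⁆
      rewrite x∈⁅y⁆⇒x≡y u x∈⁅u⁆ | x∈⁅y⁆⇒x≡y u y∈⁅u⁆ = irrefl G u

    all-universal : ∀ x → x ∈ C → x ∉ ⁅ u ⁆ → Universal C x
    all-universal x x∈C _ =
      ¬nonUniversal⇒universal λ x-nu → U-empty (x , ∈-subset⁺ (nonUniversalIn? C) (x∈C , x-nu))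

  _∈N[_] : V → V → Set
  z ∈N[ x ] = z ≡ x ⊎ z ~ x

  _∈N[_]? : ∀ z x → Dec (z ∈N[ x ])
  z ∈N[ x ]? = (z ≟ x) ⊎-dec (adj G z x ≟ᴮ true)

  ∉N[]⇒≢ : ¬ z ∈N[ x ] → z ≢ x
  ∉N[]⇒≢ z∉N[x] = z∉N[x] ∘ inj₁

  ∉N[]⇒≁ : ¬ z ∈N[ x ] → z ≁ x
  ∉N[]⇒≁ z∉N[x] = ¬~⇒≁ (z∉N[x] ∘ inj₂)

  module _ {C : Subset (n G)} (connected : ∀ x y → x ∈ C → y ∈ C → WalkIn G C x y)
           (P4-free : FreeOf IsInducedP4 C) (paw-free : FreeOf IsInducedPaw C) (C4-free : FreeOf IsInducedC4 C)
           where

    -- A vertex z outside N[x] ∪ N[y] next to a vertex z′ ∈ N(x) spans a paw or a P₄ with x, y, z′.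
    no-escape : x ∈ C → y ∈ C → z ∈ C → z′ ∈ C → x ~ y → z′ ∈N[ x ] → z ~ z′ →
      ¬ z ∈N[ x ] → ¬ z ∈N[ y ] → ⊥
    no-escape _ _ _ _ _ (inj₁ refl) z~x z∉N[x] _ = z∉N[x] (inj₂ z~x)
    no-escape {x} {y} {z} {z′} x∈C y∈C z∈C z′∈C x~y (inj₂ z′~x) z~z′ z∉N[x] z∉N[y] with adj G z′ y in z′y
    ... | true = paw-free x∈C y∈C z′∈C z∈C
          (x~y , ~-sym z′y , z′~x , ~-sym z~z′ , ≁-sym z≁x , ≁-sym z≁y , ≢-sym z≢x , ≢-sym z≢y)
      where
      z≢x = ∉N[]⇒≢ z∉N[x]
      z≢y = ∉N[]⇒≢ z∉N[y]
      z≁x = ∉N[]⇒≁ z∉N[x]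
      z≁y = ∉N[]⇒≁ z∉N[y]
    ... | false = P4-free z∈C z′∈C x∈C y∈C
          (z~z′ , z′~x , x~y , ∉N[]⇒≁ z∉N[x] , ∉N[]⇒≁ z∉N[y] , z′y ,
           ∉N[]⇒≢ z∉N[x] , ∉N[]⇒≢ z∉N[y] , λ { refl → z∉N[y] (inj₂ z~z′) })

    edge-dominates : x ∈ C → y ∈ C → x ~ y → z ∈ C → z ∈N[ x ] ⊎ z ∈N[ y ]
    edge-dominates {x} {y} x∈C y∈C x~y z∈C = along z∈C (connected _ x z∈C x∈C)
      where
      along : ∀ {z} → z ∈ C → WalkIn G C z x → z ∈N[ x ] ⊎ z ∈N[ y ]
      along _ here = inj₁ (inj₁ refl)
      along {z} z∈C (step z~z′ z′∈C w) with z ∈N[ x ]? | z ∈N[ y ]? | along z′∈C w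
      ... | yes z∈N[x] | _ | _ = inj₁ z∈N[x]
      ... | no _ | yes z∈N[y] | _ = inj₂ z∈N[y]
      ... | no z∉N[x] | no z∉N[y] | inj₁ z′∈N[x] =
        ⊥-elim (no-escape x∈C y∈C z∈C z′∈C x~y z′∈N[x] z~z′ z∉N[x] z∉N[y])
      ... | no z∉N[x] | no z∉N[y] | inj₂ z′∈N[y] =
        ⊥-elim (no-escape y∈C x∈C z∈C z′∈C (~-sym x~y) z′∈N[y] z~z′ z∉N[y] z∉N[x])

    non-neighbour-of-end : x ∈ C → y ∈ C → x ~ y → a ∈ C → a ≢ x → x ≁ a → a ~ y
    non-neighbour-of-end x∈C y∈C x~y a∈C a≢x x≁a with edge-dominates x∈C y∈C x~y a∈C
    ... | inj₁ (inj₁ a≡x) = contradiction a≡x a≢x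
    ... | inj₁ (inj₂ a~x) = contradiction (~-sym a~x) (≁⇒¬~ x≁a)
    ... | inj₂ (inj₁ refl) = contradiction x~y (≁⇒¬~ x≁a)
    ... | inj₂ (inj₂ a~y) = a~y

    connected-free⇒nonUniversalIndependent : NonUniversalIndependent C
    connected-free⇒nonUniversalIndependent {x} {y} x∈C y∈C (a , a∈C , a≢x , x≁a) (b , b∈C , b≢y , y≁b)
      with adj G x y in x~y
    ... | false = refl
    ... | true = ⊥-elim (C4-or-P4 (non-neighbour-of-end x∈C y∈C x~y a∈C a≢x x≁a)
                                  (non-neighbour-of-end y∈C x∈C (~-sym x~y) b∈C b≢y y≁b))
      where
      C4-or-P4 : a ~ y → b ~ x → ⊥
      C4-or-P4 a~y b~x with adj G a b in ab
      ... | true = C4-free x∈C y∈C a∈C b∈C (x~y , ~-sym a~y , ab , b~x , x≁a , y≁b , ≢-sym a≢x , ≢-sym b≢y)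
      ... | false = P4-free b∈C x∈C y∈C a∈C
            (b~x , x~y , ~-sym a~y , ≁-sym y≁b , ≁-sym ab , x≁a , b≢y , (λ { refl → ≁⇒¬~ y≁b (~-sym a~y) }) , ≢-sym a≢x)

  free⇒LUCS : Free3 gem K₁∨paw W₄ G → LUCS G
  free⇒LUCS (gem-free , K₁∨paw-free , W₄-free) v C (C⊆N[v] , C-nonempty , C-connected , _) =
    nonUniversalIndependent⇒completeSplit C-nonempty
      (connected-free⇒nonUniversalIndependent C-connected
        (cone-free gem cone-P4⇒gem gem-free C⊆N[v])
        (cone-free K₁∨paw cone-paw⇒K₁∨paw K₁∨paw-free C⊆N[v])
        (cone-free W₄ cone-C4⇒W₄ W₄-free C⊆N[v]))

  -- c – a – d – b is a path in N(v), so all four lie in the component of a.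
  LUCS⇒no-adjacent-nonUniversal : LUCS G → v ~ a → v ~ b → v ~ c → v ~ d → c ~ a → a ~ d → d ~ b →
    b ≢ a → a ≁ b → (∀ {C} → b ∈ C → d ∈ C → NonUniversal C c) → ⊥
  LUCS⇒no-adjacent-nonUniversal lucs v~a v~b v~c v~d c~a a~d d~b b≢a a≁b c-nonUniversal
    with component-containing v~a
  ... | C , C-component@(_ , _ , _ , closed) , a∈C =
    ≁⇒¬~ (completeSplit⇒nonUniversalIndependent (lucs _ C C-component) a∈C c∈C
            (_ , b∈C , b≢a , a≁b) (c-nonUniversal b∈C d∈C))
         (~-sym c~a)
    where
    c∈C = closed _ _ a∈C v~c (~-sym c~a)
    d∈C = closed _ _ a∈C v~d a~d
    b∈C = closed _ _ d∈C v~b d~b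

  LUCS⇒free : LUCS G → Free3 gem K₁∨paw W₄ G
  LUCS⇒free lucs = gem-free , K₁∨paw-free , W₄-free
    where
    gem-free : ¬ InducedSub gem G
    gem-free (f , f-inj , f-adj) =
      LUCS⇒no-adjacent-nonUniversal lucs (f-adj i4 i0) (f-adj i4 i1) (f-adj i4 i2) (f-adj i4 i3)
        (f-adj i2 i0) (f-adj i0 i3) (f-adj i3 i1) ((λ ()) ∘ f-inj) (f-adj i0 i1)
        λ f1∈C _ → f i1 , f1∈C , (λ ()) ∘ f-inj , f-adj i2 i1

    K₁∨paw-free : ¬ InducedSub K₁∨paw G
    K₁∨paw-free (f , f-inj , f-adj) =
      LUCS⇒no-adjacent-nonUniversal lucs (f-adj i4 i0) (f-adj i4 i1) (f-adj i4 i2) (f-adj i4 i3)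
        (f-adj i2 i0) (f-adj i0 i3) (f-adj i3 i1) ((λ ()) ∘ f-inj) (f-adj i0 i1)
        λ f1∈C _ → f i1 , f1∈C , (λ ()) ∘ f-inj , f-adj i2 i1

    W₄-free : ¬ InducedSub W₄ G
    W₄-free (f , f-inj , f-adj) =
      LUCS⇒no-adjacent-nonUniversal lucs (f-adj i4 i0) (f-adj i4 i1) (f-adj i4 i2) (f-adj i4 i3)
        (f-adj i2 i0) (f-adj i0 i3) (f-adj i3 i1) ((λ ()) ∘ f-inj) (f-adj i0 i1)
        λ _ f3∈C → f i3 , f3∈C , (λ ()) ∘ f-inj , f-adj i2 i3

lemma3 : (G : Graph) →
    LUCS G ⇔ Free3 (complement P4+K1) (complement P3+2K1) (complement 2K2+K1) G
lemma3 G = mk⇔ (LUCS⇒free G) (free⇒LUCS G)
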